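{- Let $n\ge 3$ and let $P(G(n))$ be the power graph of the gyrogroup $(G(n),\oplus)$ described in the context. Then its resolving polynomial is $$\psi(P(G(n)),x)=x^{2^n}+2^n x^{2^n-1}+(2^{2n-2}+2^{n-1}-1)x^{2^n-2}+(2^{2n-2}-2^{n-1})x^{2^n-3}.$$
   Context: Let $n\ge 3$ and $m=2^{n-1}$. Put $P(n)=\{0,1,\dots,m-1\}$, $H(n)=\{m,m+1,\dots,2^n-1\}$ and $G(n)=P(n)\cup H(n)$. Define a binary operation $\oplus$ on $G(n)$ by: $i\oplus j=t$ if $(i,j)\in P(n)\times P(n)$; $i\oplus j=t+m$ if $(i,j)\in P(n)\times H(n)$; $i\oplus j=s+m$ if $(i,j)\in H(n)\times P(n)$; $i\oplus j=k$ if $(i,j)\in H(n)\times H(n)$, where $t,s,k\in P(n)$ are determined by $t\equiv i+j$, $s\equiv i+(\tfrac m2-1)j$, $k\equiv(\tfrac m2+1)i+(\tfrac m2-1)j \pmod m$. Then $(G(n),\oplus)$ is a gyrogroup with identity $e=0$. Powers are defined by $a^1=a$, $a^{k+1}=a\oplus a^k$. The power graph $P(G(n))$ is the simple undirected graph with vertex set $G(n)$ in which two distinct vertices $u,v$ are adjacent if and only if $u^k=v$ or $v^k=u$ for some positive integer $k$. For a connected graph $G$ with shortest-path distance $d$, a set $U\subseteq V(G)$ is resolving if for every two distinct vertices $v,w$ there is $u\in U$ with $d(v,u)\ne d(w,u)$; the metric dimension $\psi(G)$ is the minimum size of a resolving set. If $r_k$ denotes the number of resolving sets of cardinality $k$,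 the resolving polynomial is $\psi(G,x)=\sum_{k=\psi(G)}^{|V(G)|} r_k x^k$. -}

module Defs where

open import Data.Nat using (ℕ; zero; suc; _+_; _*_; _∸_; _^_; _≤_; _<_; _<ᵇ_; _≡ᵇ_)
open import Data.Nat.DivMod using (_%_)
open import Data.Bool using (Bool; true; false; if_then_else_)
open import Data.Fin using (Fin; toℕ)
open import Data.Fin.Subset using (Subset; _∈_; ∣_∣)
open import Data.List using (List; []; _∷_; length; sum; map)
open import Data.List.Relation.Unary.Unique.Propositional using (Unique)
import Data.List.Membership.Propositional as LMem
open import Data.Product using (Σ; ∃; ∃-syntax; _×_; _,_)
open import Data.Sum using (_⊎_)
open import Relation.Binary.PropositionalEquality using (_≡_; _≢_)
open import Function.Bundles using (_⇔_)

-- m = 2^(n-1); P(n) = {0..m-1}, H(n) = {m..2^n-1}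
half : ℕ → ℕ
half n = 2 ^ (n ∸ 1)

quarter : ℕ → ℕ
quarter n = 2 ^ (n ∸ 2)

-- the gyrogroup operation ⊕ on G(n) = {0,…,2^n - 1}, elements coded as naturals
gyro : ℕ → ℕ → ℕ → ℕ
gyro n i j with i <ᵇ half n | j <ᵇ half n
... | true  | true  = (i + j) % suc (half n ∸ 1)
... | true  | false = (i + j) % suc (half n ∸ 1) + half n
... | false | true  = (i + (quarter n ∸ 1) * j) % suc (half n ∸ 1) + half n
... | false | false = ((quarter n + 1) * i + (quarter n ∸ 1) * j) % suc (half n ∸ 1)
-- (suc (half n ∸ 1) = half n since half n ≥ 1; written this way so the
--  NonZero instance for _%_ is found automatically)

-- powers: pow n a k = a^(k+1), i.e. a^1 = a, a^(k+1) = a ⊕ a^k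
pow : ℕ → ℕ → ℕ → ℕ
pow n a zero    = a
pow n a (suc k) = gyro n a (pow n a k)

N : ℕ → ℕ
N n = 2 ^ n

Adj : (n : ℕ) → Fin (N n) → Fin (N n) → Set
Adj n u v = (toℕ u ≢ toℕ v) ×
  ((∃[ k ] pow n (toℕ u) k ≡ toℕ v) ⊎ (∃[ k ] pow n (toℕ v) k ≡ toℕ u))

data Walk (n : ℕ) : Fin (N n) → Fin (N n) → ℕ → Set where
  here : ∀ {u} → Walk n u u 0
  step : ∀ {u v w ℓ} → Adj n u v → Walk n v w ℓ → Walk n u w (suc ℓ)

Dist : (n : ℕ) → Fin (N n) → Fin (N n) → ℕ → Set
Dist n u v ℓ = Walk n u v ℓ × (∀ ℓ' → Walk n u v ℓ' → ℓ ≤ ℓ')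

Resolving : (n : ℕ) → Subset (N n) → Set
Resolving n U = ∀ (v w : Fin (N n)) → v ≢ w →
  ∃[ u ] (u ∈ U × ∃[ d₁ ] ∃[ d₂ ] (Dist n v u d₁ × Dist n w u d₂ × d₁ ≢ d₂))

-- "r_k = c": the number of resolving sets of cardinality k equals c
NumResolving : (n k c : ℕ) → Set
NumResolving n k c = ∃[ L ] (Unique L × length L ≡ c ×
  (∀ (U : Subset (N n)) → (U LMem.∈ L) ⇔ (∣ U ∣ ≡ k × Resolving n U)))

-- a polynomial with ℕ coefficients, given as a list of (coefficient, exponent) monomials
Poly : Set
Poly = List (ℕ × ℕ)

coeff : Poly → ℕ → ℕ
coeff [] k = 0
coeff ((c , e) ∷ p) k = (if e ≡ᵇ k then c else 0) + coeff p k

targetPoly : ℕ → Poly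
targetPoly n =
    (1 , N n)
  ∷ (2 ^ n , N n ∸ 1)
  ∷ (2 ^ (2 * n ∸ 2) + 2 ^ (n ∸ 1) ∸ 1 , N n ∸ 2)
  ∷ (2 ^ (2 * n ∸ 2) ∸ 2 ^ (n ∸ 1) , N n ∸ 3)
  ∷ []

{-# OPTIONS --safe #-}
-- Under ⊕, P(n) is the cyclic group ℤ/m, while every h in H(n) satisfies h ⊕ h = 0 and h ⊕ 0 = h.
-- As m is a power of two, of two elements of ℤ/m one is a multiple of the other, so in the power
-- graph 0 is adjacent to every vertex, P(n) is a clique and H(n) is independent. Distances
-- between distinct vertices are 1 or 2 and depend only on the kinds (0, P(n) ∖ {0}, H(n)) of the
-- endpoints; hence, as soon as P(n) ∖ {0} and H(n) both have two elements, a set is resolving iff it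
-- misses at most one vertex of each kind. Choosing the missed vertices kind by kind, the resolving
-- polynomial is (x + 1)(x^(m-1) + (m-1) x^(m-2))(x^m + m x^(m-1)).
module Submission where

open import Defs
open import Data.Bool.Base using (Bool; true; false; T; if_then_else_)
import Data.Bool.Properties as Bool
open import Data.Empty using (⊥-elim)
open import Data.Fin.Base using (Fin; toℕ; fromℕ<; zero; suc)
import Data.Fin.Properties as Fin
open import Data.Fin.Properties using (toℕ<n; toℕ-fromℕ<; toℕ-injective)
open import Data.Fin.Subset using (Subset; _∈_; _∉_; _∪_; ∁; ⊥; ⁅_⁆; ∣_∣; inside; outside)
open import Data.Fin.Subset.Properties
  using ( _∈?_; ∉⊥; x∈⁅x⁆; x∈⁅y⁆⇒x≡y; ∣⊥∣≡0; ∣⁅x⁆∣≡1; x∈p∪q⁻; x∈p∪q⁺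
        ; x∈∁p⇒x∉p; x∉∁p⇒x∈p; x∉p⇒x∈∁p; ∣∁p∣≡n∸∣p∣; ⊆-antisym)
open import Data.List.Base
  using (List; []; _∷_; _++_; map; filter; concatMap; length; allFin; cartesianProduct)
open import Data.List.Properties
  using (length-map; length-++; length-tabulate; filter-++; filter-all; filter-none; map-cong)
open import Data.List.Membership.Propositional using (find) renaming (_∈_ to _∈ₗ_)
open import Data.List.Membership.Propositional.Properties
  using ( ∈-map⁺; ∈-map⁻; ∈-allFin; ∈-cartesianProduct⁺; ∈-cartesianProduct⁻
        ; ∈-concatMap⁺; ∈-concatMap⁻; ∈-map∘filter⁻; ∈-map∘filter⁺)
open import Data.List.Relation.Binary.Disjoint.Propositional using (Disjoint)
open import Data.List.Relation.Unary.All as All using (All; [])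
import Data.List.Relation.Unary.Any as Any
open import Data.List.Relation.Unary.Any using (here; there)
open import Data.List.Relation.Unary.Unique.Propositional using (Unique; []; _∷_)
open import Data.List.Relation.Unary.Unique.Propositional.Properties
  using (map⁺; allFin⁺; cartesianProduct⁺; filter⁺; ++⁺)
import Data.List.Relation.Unary.Unique.DecPropositional as DecUnique
open import Data.Maybe.Base using (Maybe; just; nothing; is-just)
open import Data.Maybe.Properties using (just-injective)
open import Data.Nat.Base
open import Data.Nat.Properties
open import Data.Nat.DivMod
open import Data.Nat.Divisibility
open import Data.Nat.GCD using (gcd; gcd-GCD; gcd[m,n]∣m; gcd[m,n]∣n; module Bézout)
open import Data.Nat.Coprimality using (Coprime; coprime-divisor)
open import Data.Nat.ListAction using (sum)
open import Data.Nat.Solver using (module +-*-Solver)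
open import Data.Product using (Σ; ∃-syntax; _×_; _,_; proj₁; proj₂)
import Data.Product as Product
import Data.Product.Properties as Product
open import Data.Sum using (_⊎_; inj₁; inj₂; [_,_])
import Data.Sum as Sum
open import Data.Vec.Base using ([]; _∷_; here; there)
open import Function using (_∘_; _⇔_; mk⇔; Equivalence)
open import Relation.Binary.PropositionalEquality
  using (_≡_; _≢_; refl; sym; trans; cong; cong₂; subst; subst₂; ≢-sym; module ≡-Reasoning)
open import Relation.Nullary using (¬_; ¬?; yes; no; contradiction; Dec)
open import Relation.Nullary.Decidable using (decidable-stable; from-yes)
open import Relation.Nullary.Reflects using (ofʸ; ofⁿ)

open Equivalence using (to; from)
open +-*-Solver

<ᵇ-true : ∀ {a b} → a < b → (a <ᵇ b) ≡ true
<ᵇ-true {a} {b} a<b with a <ᵇ b | <ᵇ-reflects-< a b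
... | true  | _        = refl
... | false | ofⁿ a≮b = contradiction a<b a≮b

<ᵇ-false : ∀ {a b} → b ≤ a → (a <ᵇ b) ≡ false
<ᵇ-false {a} {b} b≤a with a <ᵇ b | <ᵇ-reflects-< a b
... | false | _        = refl
... | true  | ofʸ a<b = contradiction a<b (≤⇒≯ b≤a)

-- Divisors of powers of two

odd⇒coprime-2 : ∀ {d} → ¬ 2 ∣ d → Coprime d 2
odd⇒coprime-2 2∤d {0}                 (_ , 0∣2) = contradiction (0∣⇒≡0 0∣2) λ ()
odd⇒coprime-2 2∤d {1}                 _         = refl
odd⇒coprime-2 2∤d {2}                 (2∣d , _) = contradiction 2∣d 2∤d
odd⇒coprime-2 2∤d {suc (suc (suc i))} (_ , i∣2) =
  contradiction (∣⇒≤ i∣2) λ { (s≤s (s≤s ())) }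

∣2^⇒≡2^ : ∀ e {d} → d ∣ 2 ^ e → ∃[ i ] d ≡ 2 ^ i
∣2^⇒≡2^ zero    d∣1 = 0 , ∣1⇒≡1 d∣1
∣2^⇒≡2^ (suc e) {d} d∣2^[1+e] with 2 ∣? d
... | no 2∤d = ∣2^⇒≡2^ e (coprime-divisor (odd⇒coprime-2 2∤d) d∣2^[1+e])
... | yes (divides k refl)
  with ∣2^⇒≡2^ e {k} (*-cancelʳ-∣ 2 (subst (k * 2 ∣_) (*-comm 2 (2 ^ e)) d∣2^[1+e]))
...   | i , refl = suc i , *-comm (2 ^ i) 2

2^-mono-∣ : ∀ {i k} → i ≤ k → 2 ^ i ∣ 2 ^ k
2^-mono-∣ {k = k} z≤n = 1∣ (2 ^ k)
2^-mono-∣ (s≤s i≤k) = *-monoʳ-∣ 2 (2^-mono-∣ i≤k)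

∣2^-total : ∀ e {a b} → a ∣ 2 ^ e → b ∣ 2 ^ e → (a ∣ b) ⊎ (b ∣ a)
∣2^-total e a∣ b∣ with ∣2^⇒≡2^ e a∣ | ∣2^⇒≡2^ e b∣
... | i , refl | k , refl with ≤-total i k
...   | inj₁ i≤k = inj₁ (2^-mono-∣ i≤k)
...   | inj₂ k≤i = inj₂ (2^-mono-∣ k≤i)

gcd∣⇒multiple : ∀ M .{{_ : NonZero M}} a {b} → gcd a M ∣ b → ∃[ c ] (c * a) % M ≡ b % M
gcd∣⇒multiple M a (divides t refl) with Bézout.identity (gcd-GCD a M)
... | Bézout.+- x y g+yM≡xa = t * x , (begin
  t * x * a % M               ≡⟨ cong (_% M) t[xa]≡tg+tyM ⟩
  (t * g + t * y * M) % M     ≡⟨ [m+kn]%n≡m%n (t * g) (t * y) M ⟩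
  t * g % M                   ∎)
  where
  open ≡-Reasoning
  g = gcd a M
  t[xa]≡tg+tyM : t * x * a ≡ t * g + t * y * M
  t[xa]≡tg+tyM = begin
    t * x * a         ≡⟨ *-assoc t x a ⟩
    t * (x * a)       ≡⟨ cong (t *_) g+yM≡xa ⟨
    t * (g + y * M)   ≡⟨ solve 4 (λ t g y M → t :* (g :+ y :* M) := t :* g :+ t :* y :* M)
                                 refl t g y M ⟩
    t * g + t * y * M ∎
... | Bézout.-+ x y g+xa≡yM = t * x * pred M , (begin
  t * x * pred M * a % M                       ≡⟨ [m+kn]%n≡m%n _ (t * y) M ⟨
  (t * x * pred M * a + t * y * M) % M         ≡⟨ cong (_% M) shift ⟩
  (t * g + t * x * a * M) % M                  ≡⟨ [m+kn]%n≡m%n (t * g) (t * x * a) M ⟩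
  t * g % M                                    ∎)
  where
  open ≡-Reasoning
  g = gcd a M
  shift : t * x * pred M * a + t * y * M ≡ t * g + t * x * a * M
  shift = begin
    t * x * pred M * a + t * y * M           ≡⟨ cong (t * x * pred M * a +_) (*-assoc t y M) ⟩
    t * x * pred M * a + t * (y * M)         ≡⟨ cong (λ z → t * x * pred M * a + t * z) g+xa≡yM ⟨
    t * x * pred M * a + t * (g + x * a)     ≡⟨ solve 5 (λ t x p a g →
                                                  t :* x :* p :* a :+ t :* (g :+ x :* a)
                                                  := t :* g :+ t :* x :* a :* (con 1 :+ p))
                                                  refl t x (pred M) a g ⟩
    t * g + t * x * a * suc (pred M)         ≡⟨ cong (λ z → t * g + t * x * a * z) (suc-pred M) ⟩
    t * g + t * x * a * M                    ∎

gcd∣⇒positive-multiple : ∀ M .{{_ : NonZero M}} a {b} → b < M → gcd a M ∣ b →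
  ∃[ k ] (suc k * a) % M ≡ b
gcd∣⇒positive-multiple M a {b} b<M g∣b with gcd∣⇒multiple M a g∣b
... | c , ca≡b = c + pred M , (begin
  suc (c + pred M) * a % M       ≡⟨ cong (_% M) (solve 3 (λ c p a →
                                      (con 1 :+ (c :+ p)) :* a := c :* a :+ a :* (con 1 :+ p))
                                      refl c (pred M) a) ⟩
  (c * a + a * suc (pred M)) % M ≡⟨ cong (λ z → (c * a + a * z) % M) (suc-pred M) ⟩
  (c * a + a * M) % M            ≡⟨ [m+kn]%n≡m%n (c * a) a M ⟩
  c * a % M                      ≡⟨ ca≡b ⟩
  b % M                          ≡⟨ m<n⇒m%n≡m b<M ⟩
  b                              ∎)
  where open ≡-Reasoning

-- The gcds with M are divisors of 2^e, hence powers of two, hence comparable under divisibility.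
positive-multiple-total : ∀ e M .{{_ : NonZero M}} → M ≡ 2 ^ e → ∀ {a b} → a < M → b < M →
  (∃[ k ] (suc k * a) % M ≡ b) ⊎ (∃[ k ] (suc k * b) % M ≡ a)
positive-multiple-total e M M≡2^e {a} {b} a<M b<M
  with ∣2^-total e (subst (gcd a M ∣_) M≡2^e (gcd[m,n]∣n a M))
                   (subst (gcd b M ∣_) M≡2^e (gcd[m,n]∣n b M))
... | inj₁ ga∣gb = inj₁ (gcd∣⇒positive-multiple M a b<M (∣-trans ga∣gb (gcd[m,n]∣m b M)))
... | inj₂ gb∣ga = inj₂ (gcd∣⇒positive-multiple M b a<M (∣-trans gb∣ga (gcd[m,n]∣m a M)))

distinct-pair : ∀ {K} → 2 ≤ K → Σ (Fin K) λ i → Σ (Fin K) λ i′ → i ≢ i′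
distinct-pair (s≤s (s≤s _)) = zero , suc zero , λ ()

∉∈⇒≢ : ∀ {K} {U : Subset K} {v u} → v ∉ U → u ∈ U → v ≢ u
∉∈⇒≢ {U = U} v∉U u∈U v≡u = v∉U (subst (_∈ U) (sym v≡u) u∈U)

∣p∪q∣≡∣p∣+∣q∣ : ∀ {K} (p q : Subset K) → (∀ {x} → x ∈ p → x ∉ q) →
  ∣ p ∪ q ∣ ≡ ∣ p ∣ + ∣ q ∣
∣p∪q∣≡∣p∣+∣q∣ []            []            _        = refl
∣p∪q∣≡∣p∣+∣q∣ (inside  ∷ p) (inside  ∷ q) disjoint = contradiction here (disjoint here)
∣p∪q∣≡∣p∣+∣q∣ (inside  ∷ p) (outside ∷ q) disjoint =
  cong suc (∣p∪q∣≡∣p∣+∣q∣ p q λ x∈p x∈q → disjoint (there x∈p) (there x∈q))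
∣p∪q∣≡∣p∣+∣q∣ (outside ∷ p) (inside  ∷ q) disjoint =
  trans (cong suc (∣p∪q∣≡∣p∣+∣q∣ p q λ x∈p x∈q → disjoint (there x∈p) (there x∈q)))
        (sym (+-suc ∣ p ∣ ∣ q ∣))
∣p∪q∣≡∣p∣+∣q∣ (outside ∷ p) (outside ∷ q) disjoint =
  ∣p∪q∣≡∣p∣+∣q∣ p q λ x∈p x∈q → disjoint (there x∈p) (there x∈q)

length-cartesianProduct : ∀ {A B : Set} (xs : List A) (ys : List B) →
  length (cartesianProduct xs ys) ≡ length xs * length ys
length-cartesianProduct []       ys = refl
length-cartesianProduct (x ∷ xs) ys = begin
  length (map (x ,_) ys ++ cartesianProduct xs ys)
    ≡⟨ length-++ (map (x ,_) ys) ⟩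
  length (map (x ,_) ys) + length (cartesianProduct xs ys)
    ≡⟨ cong₂ _+_ (length-map (x ,_) ys) (length-cartesianProduct xs ys) ⟩
  length ys + length xs * length ys
    ∎
  where open ≡-Reasoning

module _ {A S : Set} (shape : A → S) (block : S → List A)
         (block-unique : ∀ s → Unique (block s))
         (block-shape : ∀ s → All (λ x → shape x ≡ s) (block s)) where

  concatMap-unique : ∀ {ss} → Unique ss → Unique (concatMap block ss)
  concatMap-unique {[]}     []                = []
  concatMap-unique {s ∷ ss} (s∉ss ∷ ss-unique) =
    ++⁺ (block-unique s) (concatMap-unique ss-unique) disjoint
    where
    disjoint : Disjoint (block s) (concatMap block ss)
    disjoint (x∈s , x∈ss) with find (∈-concatMap⁻ block x∈ss)
    ... | s′ , s′∈ss , x∈s′ =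
      All.lookup s∉ss s′∈ss (trans (sym (All.lookup (block-shape s) x∈s)) (All.lookup (block-shape s′) x∈s′))

module _ {A S : Set} (deg : A → ℕ) (block : S → List A) (exponent : S → ℕ)
         (homogeneous : ∀ s → All (λ x → deg x ≡ exponent s) (block s)) where

  length-filter-homogeneous : ∀ s k →
    length (filter (λ x → deg x ≟ k) (block s)) ≡ (if exponent s ≡ᵇ k then length (block s) else 0)
  length-filter-homogeneous s k with exponent s ≡ᵇ k in e≡ᵇk
  ... | true  = cong length (filter-all (λ x → deg x ≟ k)
    (All.map (λ deg≡e → trans deg≡e (≡ᵇ⇒≡ _ _ (subst T (sym e≡ᵇk) _))) (homogeneous s)))
  ... | false = cong length (filter-none (λ x → deg x ≟ k)
    (All.map (λ deg≡e deg≡k → subst T e≡ᵇk (≡⇒≡ᵇ _ _ (trans (sym deg≡e) deg≡k))) (homogeneous s)))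

  length-filter-concatMap : ∀ ss k →
    length (filter (λ x → deg x ≟ k) (concatMap block ss))
      ≡ coeff (map (λ s → length (block s) , exponent s) ss) k
  length-filter-concatMap []       k = refl
  length-filter-concatMap (s ∷ ss) k = begin
    length (filter (λ x → deg x ≟ k) (block s ++ concatMap block ss))
      ≡⟨ cong length (filter-++ (λ x → deg x ≟ k) (block s) _) ⟩
    length (filter (λ x → deg x ≟ k) (block s) ++ filter (λ x → deg x ≟ k) (concatMap block ss))
      ≡⟨ length-++ (filter (λ x → deg x ≟ k) (block s)) ⟩
    length (filter (λ x → deg x ≟ k) (block s)) + length (filter (λ x → deg x ≟ k) (concatMap block ss))
      ≡⟨ cong₂ _+_ (length-filter-homogeneous s k) (length-filter-concatMap ss k) ⟩
    coeff (map (λ s → length (block s) , exponent s) (s ∷ ss)) k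
      ∎
    where open ≡-Reasoning

coeff-++ : ∀ p q k → coeff (p ++ q) k ≡ coeff p k + coeff q k
coeff-++ []              q k = refl
coeff-++ ((c , e) ∷ p)   q k =
  trans (cong (_ +_) (coeff-++ p q k)) (sym (+-assoc (if e ≡ᵇ k then c else 0) (coeff p k) (coeff q k)))

if-+ : ∀ b x y → (if b then x else 0) + (if b then y else 0) ≡ (if b then x + y else 0)
if-+ true  x y = refl
if-+ false x y = refl

coeff-same-exponent : ∀ cs e k → coeff (map (_, e) cs) k ≡ (if e ≡ᵇ k then sum cs else 0)
coeff-same-exponent []       e k with e ≡ᵇ k
... | true  = refl
... | false = refl
coeff-same-exponent (c ∷ cs) e k =
  trans (cong (_ +_) (coeff-same-exponent cs e k)) (if-+ (e ≡ᵇ k) c (sum cs))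

collect-like-terms : ∀ (groups : List (List ℕ × ℕ)) k →
  coeff (concatMap (λ (cs , e) → map (_, e) cs) groups) k ≡ coeff (map (λ (cs , e) → sum cs , e) groups) k
collect-like-terms []                k = refl
collect-like-terms ((cs , e) ∷ groups) k = begin
  coeff (map (_, e) cs ++ concatMap _ groups) k
    ≡⟨ coeff-++ (map (_, e) cs) _ k ⟩
  coeff (map (_, e) cs) k + coeff (concatMap _ groups) k
    ≡⟨ cong₂ _+_ (coeff-same-exponent cs e k) (collect-like-terms groups k) ⟩
  coeff (map (λ (cs , e) → sum cs , e) ((cs , e) ∷ groups)) k
    ∎
  where open ≡-Reasoning

-- Kinds of vertices

-- The identity 0, the nonzero elements of P(n), and the elements of H(n).
data Kind : Set where
  neutral cyclic involution : Kind

data Linked : Kind → Kind → Set where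
  neutral-any   : ∀ {k} → Linked neutral k
  any-neutral   : ∀ {k} → Linked k neutral
  cyclic-cyclic : Linked cyclic cyclic

Linked-sym : ∀ {k l} → Linked k l → Linked l k
Linked-sym neutral-any   = any-neutral
Linked-sym any-neutral   = neutral-any
Linked-sym cyclic-cyclic = cyclic-cyclic

linked? : ∀ k l → Dec (Linked k l)
linked? neutral    l          = yes neutral-any
linked? cyclic     neutral    = yes any-neutral
linked? involution neutral    = yes any-neutral
linked? cyclic     cyclic     = yes cyclic-cyclic
linked? cyclic     involution = no λ ()
linked? involution cyclic     = no λ ()
linked? involution involution = no λ ()

kindDistance : Kind → Kind → ℕ
kindDistance k l with linked? k l
... | yes _ = 1
... | no  _ = 2

kindDistance-positive : ∀ k l → 0 < kindDistance k l
kindDistance-positive k l with linked? k l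
... | yes _ = z<s
... | no  _ = z<s

separating-kind : ∀ {k l} → k ≢ l →
  ∃[ κ ] (κ ≢ neutral × kindDistance k κ ≢ kindDistance l κ)
separating-kind {neutral}    {neutral}    k≢l = contradiction refl k≢l
separating-kind {neutral}    {cyclic}     _   = involution , (λ ()) , (λ ())
separating-kind {neutral}    {involution} _   = cyclic , (λ ()) , (λ ())
separating-kind {cyclic}     {neutral}    _   = involution , (λ ()) , (λ ())
separating-kind {cyclic}     {cyclic}     k≢l = contradiction refl k≢l
separating-kind {cyclic}     {involution} _   = cyclic , (λ ()) , (λ ())
separating-kind {involution} {neutral}    _   = cyclic , (λ ()) , (λ ())
separating-kind {involution} {cyclic}     _   = cyclic , (λ ()) , (λ ())
separating-kind {involution} {involution} k≢l = contradiction refl k≢l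

Shape : Set
Shape = Bool × Bool × Bool

bit : Bool → ℕ
bit false = 0
bit true  = 1

weight : Shape → ℕ
weight (a , b , c) = bit a + (bit b + bit c)

-- Listed by weight, so that monomials of equal degree end up adjacent (see `groupedByWeight`).
shapes : List Shape
shapes = (false , false , false)
       ∷ (true  , false , false) ∷ (false , true  , false) ∷ (false , false , true)
       ∷ (true  , true  , false) ∷ (true  , false , true)  ∷ (false , true  , true)
       ∷ (true  , true  , true)  ∷ []

shapes-unique : Unique shapes
shapes-unique =
  from-yes (DecUnique.unique? (Product.≡-dec Bool._≟_ (Product.≡-dec Bool._≟_ Bool._≟_)) shapes)

∈-shapes : ∀ s → s ∈ₗ shapes
∈-shapes (false , false , false) = here refl
∈-shapes (true  , false , false) = there (here refl)
∈-shapes (false , true  , false) = there (there (here refl))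
∈-shapes (false , false , true)  = there (there (there (here refl)))
∈-shapes (true  , true  , false) = there (there (there (there (here refl))))
∈-shapes (true  , false , true)  = there (there (there (there (there (here refl)))))
∈-shapes (false , true  , true)  = there (there (there (there (there (there (here refl))))))
∈-shapes (true  , true  , true)  = there (there (there (there (there (there (there (here refl)))))))

choices : Bool → (K : ℕ) → List (Maybe (Fin K))
choices false K = nothing ∷ []
choices true  K = map just (allFin K)

choices-unique : ∀ b K → Unique (choices b K)
choices-unique false K = [] ∷ []
choices-unique true  K = map⁺ just-injective (allFin⁺ K)

∈-choices : ∀ {K} (x : Maybe (Fin K)) → x ∈ₗ choices (is-just x) K
∈-choices nothing  = here refl
∈-choices (just i) = ∈-map⁺ just (∈-allFin i)

is-just-choices : ∀ {b K x} → x ∈ₗ choices b K → is-just x ≡ b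
is-just-choices {false} (here refl) = refl
is-just-choices {true}  x∈ with ∈-map⁻ just x∈
... | _ , _ , refl = refl

length-choices : ∀ b K → length (choices b K) ≡ (if b then K else 1)
length-choices false K = refl
length-choices true  K = trans (length-map just (allFin K)) (length-tabulate (λ i → i))

-- The sums of the multiplicities of the shapes of weight 1, 2 and 3, for x = m = D + 1.
weight-1-total : ∀ D x → suc D ≡ x → 1 * (1 * 1) + (1 * (D * 1) + (1 * (1 * x) + 0)) ≡ x + x
weight-1-total D _ refl = solve 1 (λ D →
  con 1 :* (con 1 :* con 1) :+ (con 1 :* (D :* con 1) :+ (con 1 :* (con 1 :* (con 1 :+ D)) :+ con 0))
  := (con 1 :+ D) :+ (con 1 :+ D)) refl D

weight-2-total : ∀ D x → suc D ≡ x → 1 * (D * 1) + (1 * (1 * x) + (1 * (D * x) + 0)) ≡ x * x + x ∸ 1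
weight-2-total D _ refl = solve 1 (λ D →
  con 1 :* (D :* con 1) :+ (con 1 :* (con 1 :* (con 1 :+ D)) :+ (con 1 :* (D :* (con 1 :+ D)) :+ con 0))
  := D :+ D :* (con 1 :+ D) :+ (con 1 :+ D)) refl D

weight-3-total : ∀ D x → suc D ≡ x → 1 * (D * x) + 0 ≡ x * x ∸ x
weight-3-total D _ refl =
  trans (solve 1 (λ D → con 1 :* (D :* (con 1 :+ D)) :+ con 0 := D :* (con 1 :+ D)) refl D)
        (sym (m+n∸m≡n D (D * suc D)))

module PowerGraph (j : ℕ) where

  n m q M : ℕ
  n = 3 + j
  m = half n
  q = quarter n
  -- the modulus exactly as it is written in `gyro`; it equals m
  M = suc (m ∸ 1)

  0<m : 0 < m
  0<m = m^n>0 2 (2 + j)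

  M≡m : M ≡ m
  M≡m = suc-pred m {{>-nonZero 0<m}}

  N≡m+m : N n ≡ m + m
  N≡m+m = cong (m +_) (*-identityˡ m)

  <m⇒<M : ∀ {a} → a < m → a < M
  <m⇒<M {a} = subst (a <_) (sym M≡m)

  %M<m : ∀ a → a % M < m
  %M<m a = subst (a % M <_) M≡m (m%n<n a M)

  ⊕-cyclic : ∀ {a b} → a < m → b < m → gyro n a b ≡ (a + b) % M
  ⊕-cyclic a<m b<m rewrite <ᵇ-true a<m | <ᵇ-true b<m = refl

  ⊕-involution-self : ∀ {a} → m ≤ a → gyro n a a ≡ 0
  ⊕-involution-self {a} m≤a rewrite <ᵇ-false m≤a = begin
    ((q + 1) * a + (q ∸ 1) * a) % M   ≡⟨ cong (_% M) (*-distribʳ-+ a (q + 1) (q ∸ 1)) ⟨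
    ((q + 1 + (q ∸ 1)) * a) % M       ≡⟨ cong (λ c → (c * a) % M) q+1+[q∸1]≡M ⟩
    (M * a) % M                       ≡⟨ cong (_% M) (*-comm M a) ⟩
    (a * M) % M                       ≡⟨ m*n%n≡0 a M ⟩
    0                                 ∎
    where
    open ≡-Reasoning
    q+1+[q∸1]≡M : q + 1 + (q ∸ 1) ≡ M
    q+1+[q∸1]≡M = begin
      q + 1 + (q ∸ 1)   ≡⟨ +-assoc q 1 (q ∸ 1) ⟩
      q + (1 + (q ∸ 1)) ≡⟨ cong (q +_) (m+[n∸m]≡n (m^n>0 2 (1 + j))) ⟩
      q + q             ≡⟨ cong (q +_) (+-identityʳ q) ⟨
      m                 ≡⟨ M≡m ⟨
      M                 ∎

  ⊕-involution-zero : ∀ {a} → m ≤ a → a < N n → gyro n a 0 ≡ a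
  ⊕-involution-zero {a} m≤a a<N rewrite <ᵇ-false m≤a | <ᵇ-true 0<m = begin
    (a + (q ∸ 1) * 0) % M + m   ≡⟨ cong (λ c → (a + c) % M + m) (*-zeroʳ (q ∸ 1)) ⟩
    (a + 0) % M + m             ≡⟨ cong (λ c → c % M + m) (+-identityʳ a) ⟩
    a % M + m                   ≡⟨ cong (_+ m) (m≤n⇒[n∸m]%m≡n%m M≤a) ⟨
    (a ∸ M) % M + m             ≡⟨ cong (_+ m) (m<n⇒m%n≡m a∸M<M) ⟩
    a ∸ M + m                   ≡⟨ cong (λ c → a ∸ c + m) M≡m ⟩
    a ∸ m + m                   ≡⟨ m∸n+n≡m m≤a ⟩
    a                           ∎
    where
    open ≡-Reasoning
    M≤a : M ≤ a
    M≤a = subst (_≤ a) (sym M≡m) m≤a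
    a∸M<M : a ∸ M < M
    a∸M<M = subst (λ c → a ∸ c < c) (sym M≡m)
      (+-cancelˡ-< m (a ∸ m) m (subst₂ _<_ (sym (m+[n∸m]≡n m≤a)) N≡m+m a<N))

  pow-cyclic : ∀ {a} → a < m → ∀ k → pow n a k ≡ (suc k * a) % M
  pow-cyclic {a} a<m zero = sym (trans (cong (_% M) (+-identityʳ a)) (m<n⇒m%n≡m (<m⇒<M a<m)))
  pow-cyclic {a} a<m (suc k) = begin
    gyro n a (pow n a k)             ≡⟨ cong (gyro n a) (pow-cyclic a<m k) ⟩
    gyro n a ((suc k * a) % M)       ≡⟨ ⊕-cyclic a<m (%M<m (suc k * a)) ⟩
    (a + (suc k * a) % M) % M        ≡⟨ %-distribˡ-+ a _ M ⟩
    (a % M + (suc k * a) % M % M) % M ≡⟨ cong (λ c → (a % M + c) % M) (m%n%n≡m%n (suc k * a) M) ⟩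
    (a % M + (suc k * a) % M) % M    ≡⟨ %-distribˡ-+ a (suc k * a) M ⟨
    (a + suc k * a) % M              ∎
    where open ≡-Reasoning

  pow-involution : ∀ {a} → m ≤ a → a < N n → ∀ k → pow n a k ≡ a ⊎ pow n a k ≡ 0
  pow-involution m≤a a<N zero = inj₁ refl
  pow-involution {a} m≤a a<N (suc k) with pow-involution m≤a a<N k
  ... | inj₁ aᵏ≡a = inj₂ (trans (cong (gyro n a) aᵏ≡a) (⊕-involution-self m≤a))
  ... | inj₂ aᵏ≡0 = inj₁ (trans (cong (gyro n a) aᵏ≡0) (⊕-involution-zero m≤a a<N))

  Reaches : ℕ → ℕ → Set
  Reaches a b = ∃[ k ] pow n a k ≡ b

  reaches-zero : ∀ {a} → a < N n → Reaches a 0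
  reaches-zero {a} a<N with a <? m
  ... | yes a<m = m ∸ 1 , trans (pow-cyclic a<m (m ∸ 1)) (trans (cong (_% M) (*-comm M a)) (m*n%n≡0 a M))
  ... | no  a≮m = 1 , ⊕-involution-self (≮⇒≥ a≮m)

  kindOf : ℕ → Kind
  kindOf zero = neutral
  kindOf (suc a) with suc a <? m
  ... | yes _ = cyclic
  ... | no  _ = involution

  data KindView (a : ℕ) : Kind → Set where
    neutral    : a ≡ 0 → KindView a neutral
    cyclic     : 0 < a → a < m → KindView a cyclic
    involution : m ≤ a → KindView a involution

  kindView : ∀ a → KindView a (kindOf a)
  kindView zero = neutral refl
  kindView (suc a) with suc a <? m
  ... | yes a<m = cyclic z<s a<m
  ... | no  a≮m = involution (≮⇒≥ a≮m)

  KindView-unique : ∀ {a k l} → KindView a k → KindView a l → k ≡ l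
  KindView-unique (neutral _)      (neutral _)      = refl
  KindView-unique (cyclic _ _)     (cyclic _ _)     = refl
  KindView-unique (involution _)   (involution _)   = refl
  KindView-unique (neutral refl)   (cyclic 0<a _)   = contradiction 0<a (λ ())
  KindView-unique (cyclic 0<a _)   (neutral refl)   = contradiction 0<a (λ ())
  KindView-unique (neutral refl)   (involution m≤a) = contradiction m≤a (<⇒≱ 0<m)
  KindView-unique (involution m≤a) (neutral refl)   = contradiction m≤a (<⇒≱ 0<m)
  KindView-unique (cyclic _ a<m)   (involution m≤a) = contradiction m≤a (<⇒≱ a<m)
  KindView-unique (involution m≤a) (cyclic _ a<m)   = contradiction m≤a (<⇒≱ a<m)

  cyclic-linked : ∀ {b} → b < m → Linked cyclic (kindOf b)
  cyclic-linked {b} b<m with kindOf b | kindView b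
  ... | neutral    | _              = any-neutral
  ... | cyclic     | _              = cyclic-cyclic
  ... | involution | involution m≤b = contradiction m≤b (<⇒≱ b<m)

  reaches⇒linked : ∀ {a b} → a < N n → a ≢ b → Reaches a b → Linked (kindOf a) (kindOf b)
  reaches⇒linked {a} {b} a<N a≢b (k , aᵏ≡b) with kindOf a | kindView a
  ... | neutral    | _              = neutral-any
  ... | cyclic     | cyclic _ a<m   =
    cyclic-linked (subst (_< m) (trans (sym (pow-cyclic a<m k)) aᵏ≡b) (%M<m (suc k * a)))
  ... | involution | involution m≤a with pow-involution m≤a a<N k
  ...   | inj₁ aᵏ≡a = contradiction (trans (sym aᵏ≡a) aᵏ≡b) a≢b
  ...   | inj₂ aᵏ≡0 = subst (Linked involution ∘ kindOf) (trans (sym aᵏ≡0) aᵏ≡b) any-neutral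

  linked⇒reaches : ∀ {a b} → a < N n → b < N n → Linked (kindOf a) (kindOf b) →
    Reaches a b ⊎ Reaches b a
  linked⇒reaches {a} {b} a<N b<N = by-views (kindView a) (kindView b)
    where
    by-views : ∀ {k l} → KindView a k → KindView b l → Linked k l → Reaches a b ⊎ Reaches b a
    by-views (neutral a≡0) _ neutral-any = inj₂ (subst (Reaches b) (sym a≡0) (reaches-zero b<N))
    by-views _ (neutral b≡0) any-neutral = inj₁ (subst (Reaches a) (sym b≡0) (reaches-zero a<N))
    by-views (cyclic _ a<m) (cyclic _ b<m) cyclic-cyclic =
      Sum.map (Product.map₂ λ {k} → trans (pow-cyclic a<m k))
              (Product.map₂ λ {k} → trans (pow-cyclic b<m k))
              (positive-multiple-total (2 + j) M M≡m (<m⇒<M a<m) (<m⇒<M b<m))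

  V : Set
  V = Fin (N n)

  kind : V → Kind
  kind v = kindOf (toℕ v)

  adjacent⇔ : ∀ {u v} → Adj n u v ⇔ (u ≢ v × Linked (kind u) (kind v))
  adjacent⇔ {u} {v} = mk⇔ adjacent⇒ ⇒adjacent
    where
    adjacent⇒ : Adj n u v → u ≢ v × Linked (kind u) (kind v)
    adjacent⇒ (u≢v , inj₁ u→v) = u≢v ∘ cong toℕ , reaches⇒linked (toℕ<n u) u≢v u→v
    adjacent⇒ (u≢v , inj₂ v→u) =
      u≢v ∘ cong toℕ , Linked-sym (reaches⇒linked (toℕ<n v) (u≢v ∘ sym) v→u)
    ⇒adjacent : u ≢ v × Linked (kind u) (kind v) → Adj n u v
    ⇒adjacent (u≢v , linked) = u≢v ∘ toℕ-injective , linked⇒reaches (toℕ<n u) (toℕ<n v) linked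

  classSize : Kind → ℕ
  classSize neutral    = 1
  classSize cyclic     = m ∸ 1
  classSize involution = m

  offset : Kind → ℕ
  offset neutral    = 0
  offset cyclic     = 1
  offset involution = m

  offset+classSize≤N : ∀ k → offset k + classSize k ≤ N n
  offset+classSize≤N neutral    = m^n>0 2 n
  offset+classSize≤N cyclic     = ≤-trans (≤-reflexive M≡m) (subst (m ≤_) (sym N≡m+m) (m≤m+n m m))
  offset+classSize≤N involution = ≤-reflexive (sym N≡m+m)

  vertex : (k : Kind) → Fin (classSize k) → V
  vertex k i = fromℕ< (<-≤-trans (+-monoʳ-< (offset k) (toℕ<n i)) (offset+classSize≤N k))

  toℕ-vertex : ∀ k i → toℕ (vertex k i) ≡ offset k + toℕ i
  toℕ-vertex k i = toℕ-fromℕ< _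

  vertex-injective : ∀ {k i i′} → vertex k i ≡ vertex k i′ → i ≡ i′
  vertex-injective {k} {i} {i′} eq = toℕ-injective (+-cancelˡ-≡ (offset k) _ _
    (trans (sym (toℕ-vertex k i)) (trans (cong toℕ eq) (toℕ-vertex k i′))))

  kindView-vertex : ∀ k i → KindView (toℕ (vertex k i)) k
  kindView-vertex neutral    zero rewrite toℕ-vertex neutral zero = neutral refl
  kindView-vertex cyclic     i    rewrite toℕ-vertex cyclic i =
    cyclic z<s (subst (suc (toℕ i) <_) M≡m (s≤s (toℕ<n i)))
  kindView-vertex involution i    rewrite toℕ-vertex involution i = involution (m≤m+n m (toℕ i))

  kind-vertex : ∀ k i → kind (vertex k i) ≡ k
  kind-vertex k i = KindView-unique (kindView _) (kindView-vertex k i)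

  kindView-index : ∀ {a k} → KindView a k → a < N n → offset k ≤ a × a ∸ offset k < classSize k
  kindView-index (neutral refl)   _   = z≤n , z<s
  kindView-index (cyclic 0<a a<m) _   = 0<a , ∸-monoˡ-< a<m 0<a
  kindView-index (involution m≤a) a<N =
    m≤a , <-≤-trans (∸-monoˡ-< a<N m≤a) (≤-reflexive (trans (cong (_∸ m) N≡m+m) (m+n∸m≡n m m)))

  vertex-surjective : ∀ v → ∃[ k ] ∃[ i ] vertex k i ≡ v
  vertex-surjective v = kind v , fromℕ< (proj₂ index) , toℕ-injective (begin
    toℕ (vertex (kind v) (fromℕ< (proj₂ index))) ≡⟨ toℕ-vertex (kind v) _ ⟩
    offset (kind v) + toℕ (fromℕ< (proj₂ index)) ≡⟨ cong (offset (kind v) +_) (toℕ-fromℕ< _) ⟩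
    offset (kind v) + (toℕ v ∸ offset (kind v))  ≡⟨ m+[n∸m]≡n (proj₁ index) ⟩
    toℕ v                                        ∎)
    where
    open ≡-Reasoning
    index : offset (kind v) ≤ toℕ v × toℕ v ∸ offset (kind v) < classSize (kind v)
    index = kindView-index (kindView (toℕ v)) (toℕ<n v)

  -- Only here is n ≥ 3 needed: it makes the cyclic kind have at least two elements.
  2≤classSize : ∀ {κ} → κ ≢ neutral → 2 ≤ classSize κ
  2≤classSize {neutral}    κ≢neutral = contradiction refl κ≢neutral
  2≤classSize {cyclic}     _ =
    ≤-trans (n≤1+n 2) (∸-monoˡ-≤ 1 (^-monoʳ-≤ 2 {2} {2 + j} (s≤s (s≤s z≤n))))
  2≤classSize {involution} _ = ^-monoʳ-≤ 2 {1} {2 + j} (s≤s z≤n)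

  e : V
  e = vertex neutral zero

  e-adjacent : ∀ {v} → e ≢ v → Adj n e v
  e-adjacent {v} e≢v =
    from adjacent⇔ (e≢v , subst (λ k → Linked k (kind v)) (sym (kind-vertex neutral zero)) neutral-any)

  adjacent-e : ∀ {v} → v ≢ e → Adj n v e
  adjacent-e v≢e = from adjacent⇔ (v≢e , subst (Linked _) (sym (kind-vertex neutral zero)) any-neutral)

  walk-length-0 : ∀ {u v} → Walk n u v 0 → u ≡ v
  walk-length-0 here = refl

  walk-length-1 : ∀ {u v} → Walk n u v 1 → Adj n u v
  walk-length-1 (step adj here) = adj

  dist-refl : ∀ {u} → Dist n u u 0
  dist-refl = here , λ _ _ → z≤n

  dist-adjacent : ∀ {u v} → Adj n u v → Dist n u v 1
  dist-adjacent {u} {v} adj = step adj here , shortest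
    where
    shortest : ∀ ℓ → Walk n u v ℓ → 1 ≤ ℓ
    shortest zero    w = contradiction (walk-length-0 w) (proj₁ (to adjacent⇔ adj))
    shortest (suc _) _ = s≤s z≤n

  dist-nonadjacent : ∀ {u v} → u ≢ v → ¬ Adj n u v → Dist n u v 2
  dist-nonadjacent {u} {v} u≢v ¬adj = step (adjacent-e u≢e) (step (e-adjacent e≢v) here) , shortest
    where
    u≢e : u ≢ e
    u≢e u≡e = ¬adj (subst (λ w → Adj n w v) (sym u≡e) (e-adjacent (λ e≡v → u≢v (trans u≡e e≡v))))
    e≢v : e ≢ v
    e≢v e≡v = ¬adj (subst (Adj n u) e≡v (adjacent-e (λ u≡e → u≢v (trans u≡e e≡v))))
    shortest : ∀ ℓ → Walk n u v ℓ → 2 ≤ ℓ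
    shortest 0             w = contradiction (walk-length-0 w) u≢v
    shortest 1             w = contradiction (walk-length-1 w) ¬adj
    shortest (suc (suc _)) _ = s≤s (s≤s z≤n)

  dist-distinct : ∀ {u v} → u ≢ v → Dist n u v (kindDistance (kind u) (kind v))
  dist-distinct {u} {v} u≢v with linked? (kind u) (kind v)
  ... | yes linked = dist-adjacent (from adjacent⇔ (u≢v , linked))
  ... | no ¬linked = dist-nonadjacent u≢v (¬linked ∘ proj₂ ∘ to adjacent⇔)

  Dist-unique : ∀ {u v d d′} → Dist n u v d → Dist n u v d′ → d ≡ d′
  Dist-unique (w , shortest) (w′ , shortest′) = ≤-antisym (shortest _ w′) (shortest′ _ w)

  -- Resolving sets

  MissesAtMostOnePerKind : Subset (N n) → Set
  MissesAtMostOnePerKind U = ∀ v w → v ≢ w → kind v ≡ kind w → v ∈ U ⊎ w ∈ U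

  member-of-kind : ∀ {U κ} → κ ≢ neutral → MissesAtMostOnePerKind U →
    ∃[ u ] (u ∈ U × kind u ≡ κ)
  member-of-kind {U} {κ} κ≢neutral sparse with distinct-pair (2≤classSize κ≢neutral)
  ... | i , i′ , i≢i′
    with sparse (vertex κ i) (vertex κ i′) (i≢i′ ∘ vertex-injective {κ})
                (trans (kind-vertex κ i) (sym (kind-vertex κ i′)))
  ... | inj₁ ∈U = vertex κ i  , ∈U , kind-vertex κ i
  ... | inj₂ ∈U = vertex κ i′ , ∈U , kind-vertex κ i′

  resolving⇒sparse : ∀ {U} → Resolving n U → MissesAtMostOnePerKind U
  resolving⇒sparse {U} resolving v w v≢w same with v ∈? U | w ∈? U
  ... | yes v∈U | _       = inj₁ v∈U
  ... | no _    | yes w∈U = inj₂ w∈U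
  ... | no v∉U  | no w∉U  with resolving v w v≢w
  ... | u , u∈U , d₁ , d₂ , v↝u , w↝u , d₁≢d₂ = contradiction (begin
    d₁                             ≡⟨ Dist-unique v↝u (dist-distinct (∉∈⇒≢ v∉U u∈U)) ⟩
    kindDistance (kind v) (kind u) ≡⟨ cong (λ k → kindDistance k (kind u)) same ⟩
    kindDistance (kind w) (kind u) ≡⟨ Dist-unique (dist-distinct (∉∈⇒≢ w∉U u∈U)) w↝u ⟩
    d₂                             ∎) d₁≢d₂
    where open ≡-Reasoning

  sparse⇒resolving : ∀ {U} → MissesAtMostOnePerKind U → Resolving n U
  sparse⇒resolving {U} sparse v w v≢w with v ∈? U | w ∈? U
  ... | yes v∈U | _ = v , v∈U , 0 , _ , dist-refl , dist-distinct (≢-sym v≢w) ,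
                      <⇒≢ (kindDistance-positive (kind w) (kind v))
  ... | no _ | yes w∈U = w , w∈U , _ , 0 , dist-distinct v≢w , dist-refl ,
                         ≢-sym (<⇒≢ (kindDistance-positive (kind v) (kind w)))
  ... | no v∉U | no w∉U with separating-kind kinds-differ
    where
    kinds-differ : kind v ≢ kind w
    kinds-differ same = [ v∉U , w∉U ] (sparse v w v≢w same)
  ... | κ , κ≢neutral , separates with member-of-kind κ≢neutral sparse
  ... | u , u∈U , refl =
    u , u∈U , _ , _ , dist-distinct (∉∈⇒≢ v∉U u∈U) , dist-distinct (∉∈⇒≢ w∉U u∈U) , separates

  resolving⇔sparse : ∀ {U} → Resolving n U ⇔ MissesAtMostOnePerKind U
  resolving⇔sparse = mk⇔ resolving⇒sparse sparse⇒resolving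

  -- Sets missing at most one vertex of each kind

  Omission : Set
  Omission = Maybe (Fin (classSize neutral))
           × Maybe (Fin (classSize cyclic))
           × Maybe (Fin (classSize involution))

  choice : (k : Kind) → Omission → Maybe (Fin (classSize k))
  choice neutral    (a , _ , _) = a
  choice cyclic     (_ , b , _) = b
  choice involution (_ , _ , c) = c

  omission-ext : ∀ {o o′} → (∀ k → choice k o ≡ choice k o′) → o ≡ o′
  omission-ext {_ , _ , _} {_ , _ , _} eq =
    cong₂ _,_ (eq neutral) (cong₂ _,_ (eq cyclic) (eq involution))

  shapeOf : Omission → Shape
  shapeOf (a , b , c) = is-just a , is-just b , is-just c

  omit : (k : Kind) → Maybe (Fin (classSize k)) → Subset (N n)
  omit k nothing  = ⊥
  omit k (just i) = ⁅ vertex k i ⁆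

  omitted : Omission → Subset (N n)
  omitted o = omit neutral (choice neutral o)
            ∪ omit cyclic (choice cyclic o)
            ∪ omit involution (choice involution o)

  retained : Omission → Subset (N n)
  retained o = ∁ (omitted o)

  vertex-kind-injective : ∀ {k k′ i i′} → vertex k i ≡ vertex k′ i′ → k ≡ k′
  vertex-kind-injective {k} {k′} {i} {i′} eq =
    trans (sym (kind-vertex k i)) (trans (cong kind eq) (kind-vertex k′ i′))

  ∈-omit⁺ : ∀ {k x i} → x ≡ just i → vertex k i ∈ omit k x
  ∈-omit⁺ refl = x∈⁅x⁆ _

  ∈-omit⁻ : ∀ k x {v} → v ∈ omit k x → ∃[ i ] (x ≡ just i × v ≡ vertex k i)
  ∈-omit⁻ k nothing  v∈⊥ = contradiction v∈⊥ ∉⊥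
  ∈-omit⁻ k (just i) v∈  = i , refl , x∈⁅y⁆⇒x≡y _ v∈

  omit-disjoint : ∀ k k′ x y {v} → k ≢ k′ → v ∈ omit k x → v ∉ omit k′ y
  omit-disjoint k k′ x y k≢k′ v∈x v∈y with ∈-omit⁻ k x v∈x | ∈-omit⁻ k′ y v∈y
  ... | i , _ , v≡ | i′ , _ , v≡′ =
    k≢k′ (vertex-kind-injective {k} {k′} {i} {i′} (trans (sym v≡) v≡′))

  ∈-omitted⁺ : ∀ k {o i} → choice k o ≡ just i → vertex k i ∈ omitted o
  ∈-omitted⁺ neutral    eq = x∈p∪q⁺ (inj₁ (∈-omit⁺ eq))
  ∈-omitted⁺ cyclic     eq = x∈p∪q⁺ (inj₂ (x∈p∪q⁺ (inj₁ (∈-omit⁺ eq))))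
  ∈-omitted⁺ involution eq = x∈p∪q⁺ (inj₂ (x∈p∪q⁺ (inj₂ (∈-omit⁺ eq))))

  ∈-omitted⁻ : ∀ {o v} → v ∈ omitted o → ∃[ k ] ∃[ i ] (choice k o ≡ just i × v ≡ vertex k i)
  ∈-omitted⁻ {a , b , c} v∈ with x∈p∪q⁻ (omit neutral a) _ v∈
  ... | inj₁ v∈a = neutral , ∈-omit⁻ neutral a v∈a
  ... | inj₂ v∈bc with x∈p∪q⁻ (omit cyclic b) _ v∈bc
  ...   | inj₁ v∈b = cyclic , ∈-omit⁻ cyclic b v∈b
  ...   | inj₂ v∈c = involution , ∈-omit⁻ involution c v∈c

  ∈-omitted⇒ : ∀ k i o → vertex k i ∈ omitted o → choice k o ≡ just i
  ∈-omitted⇒ k i o v∈ with ∈-omitted⁻ {o} v∈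
  ... | k′ , i′ , eq , v≡ with vertex-kind-injective {k} {k′} {i} {i′} v≡
  ...   | refl = trans eq (cong just (sym (vertex-injective {k} {i} {i′} v≡)))

  ∣omit∣ : ∀ k x → ∣ omit k x ∣ ≡ bit (is-just x)
  ∣omit∣ k nothing  = ∣⊥∣≡0 (N n)
  ∣omit∣ k (just i) = ∣⁅x⁆∣≡1 (vertex k i)

  ∣retained∣ : ∀ o → ∣ retained o ∣ ≡ N n ∸ weight (shapeOf o)
  ∣retained∣ o@(a , b , c) = begin
    ∣ ∁ (A ∪ B ∪ C) ∣
      ≡⟨ ∣∁p∣≡n∸∣p∣ (A ∪ B ∪ C) ⟩
    N n ∸ ∣ A ∪ B ∪ C ∣
      ≡⟨ cong (N n ∸_) (∣p∪q∣≡∣p∣+∣q∣ A (B ∪ C) A-disjoint) ⟩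
    N n ∸ (∣ A ∣ + ∣ B ∪ C ∣)
      ≡⟨ cong (λ x → N n ∸ (∣ A ∣ + x)) (∣p∪q∣≡∣p∣+∣q∣ B C (omit-disjoint cyclic involution b c λ ())) ⟩
    N n ∸ (∣ A ∣ + (∣ B ∣ + ∣ C ∣))
      ≡⟨ cong₂ (λ x y → N n ∸ (x + y)) (∣omit∣ neutral a)
               (cong₂ _+_ (∣omit∣ cyclic b) (∣omit∣ involution c)) ⟩
    N n ∸ weight (shapeOf o)
      ∎
    where
    open ≡-Reasoning
    A = omit neutral a
    B = omit cyclic b
    C = omit involution c
    A-disjoint : ∀ {v} → v ∈ A → v ∉ B ∪ C
    A-disjoint v∈A v∈BC = [ omit-disjoint neutral cyclic a b (λ ()) v∈A
                          , omit-disjoint neutral involution a c (λ ()) v∈A ] (x∈p∪q⁻ B C v∈BC)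

  retained-sparse : ∀ o → MissesAtMostOnePerKind (retained o)
  retained-sparse o v w v≢w same with v ∈? retained o | w ∈? retained o
  ... | yes v∈ | _      = inj₁ v∈
  ... | no _   | yes w∈ = inj₂ w∈
  ... | no v∉  | no w∉ with vertex-surjective v | vertex-surjective w
  ... | k , i , refl | k′ , i′ , refl with trans (sym (kind-vertex k i)) (trans same (kind-vertex k′ i′))
  ... | refl = ⊥-elim (v≢w (cong (vertex k) (just-injective
    (trans (sym (∈-omitted⇒ k i o (x∉∁p⇒x∈p v∉))) (∈-omitted⇒ k i′ o (x∉∁p⇒x∈p w∉))))))

  data Omits (U : Subset (N n)) (k : Kind) : Maybe (Fin (classSize k)) → Set where
    none : (∀ i → vertex k i ∈ U) → Omits U k nothing
    some : ∀ {i} → vertex k i ∉ U → Omits U k (just i)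

  Omits-∉ : ∀ {U k i} → Omits U k (just i) → vertex k i ∉ U
  Omits-∉ (some i∉) = i∉

  omittedIn : ∀ U k → Σ (Maybe (Fin (classSize k))) (Omits U k)
  omittedIn U k with Fin.any? (λ i → ¬? (vertex k i ∈? U))
  ... | yes (i , i∉U) = just i , some i∉U
  ... | no  ¬any      =
    nothing , none λ i → decidable-stable (vertex k i ∈? U) (λ i∉U → ¬any (i , i∉U))

  omissionOf : Subset (N n) → Omission
  omissionOf U = proj₁ (omittedIn U neutral) , proj₁ (omittedIn U cyclic) , proj₁ (omittedIn U involution)

  omissionOf-omits : ∀ U k → Omits U k (choice k (omissionOf U))
  omissionOf-omits U neutral    = proj₂ (omittedIn U neutral)
  omissionOf-omits U cyclic     = proj₂ (omittedIn U cyclic)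
  omissionOf-omits U involution = proj₂ (omittedIn U involution)

  Omits-retained : ∀ {o k x} → Omits (retained o) k x → x ≡ choice k o
  Omits-retained {o} {k} (none all∈) with choice k o in eq
  ... | nothing = refl
  ... | just i  = contradiction (∈-omitted⁺ k eq) (x∈∁p⇒x∉p (all∈ i))
  Omits-retained {o} {k} (some {i} i∉) = sym (∈-omitted⇒ k i o (x∉∁p⇒x∈p i∉))

  omissionOf-retained : ∀ o → omissionOf (retained o) ≡ o
  omissionOf-retained o = omission-ext λ k → Omits-retained (omissionOf-omits (retained o) k)

  retained-injective : ∀ {o o′} → retained o ≡ retained o′ → o ≡ o′
  retained-injective {o} {o′} eq =
    trans (sym (omissionOf-retained o)) (trans (cong omissionOf eq) (omissionOf-retained o′))

  Omits-sparse : ∀ {U k x i} → MissesAtMostOnePerKind U → Omits U k x → vertex k i ∉ U →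
    x ≡ just i
  Omits-sparse _ (none all∈) i∉ = contradiction (all∈ _) i∉
  Omits-sparse {k = k} {i = i} sparse (some {i′} i′∉) i∉ with i Fin.≟ i′
  ... | yes refl = refl
  ... | no  i≢i′ = ⊥-elim ([ i∉ , i′∉ ] (sparse (vertex k i) (vertex k i′) (i≢i′ ∘ vertex-injective {k})
                                                (trans (kind-vertex k i) (sym (kind-vertex k i′)))))

  retained-omissionOf : ∀ {U} → MissesAtMostOnePerKind U → retained (omissionOf U) ≡ U
  retained-omissionOf {U} sparse = ⊆-antisym ⊆U U⊆
    where
    ⊆U : ∀ {v} → v ∈ retained (omissionOf U) → v ∈ U
    ⊆U {v} v∈ with vertex-surjective v
    ... | k , i , refl = decidable-stable (vertex k i ∈? U) λ v∉U →
      x∈∁p⇒x∉p v∈ (∈-omitted⁺ k (Omits-sparse sparse (omissionOf-omits U k) v∉U))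
    U⊆ : ∀ {v} → v ∈ U → v ∈ retained (omissionOf U)
    U⊆ {v} v∈U with vertex-surjective v
    ... | k , i , refl = x∉p⇒x∈∁p λ v∈omitted →
      Omits-∉ (subst (Omits U k) (∈-omitted⇒ k i (omissionOf U) v∈omitted) (omissionOf-omits U k)) v∈U

  ofShape : Shape → List Omission
  ofShape (a , b , c) = cartesianProduct (choices a _) (cartesianProduct (choices b _) (choices c _))

  ofShape-unique : ∀ s → Unique (ofShape s)
  ofShape-unique (a , b , c) =
    cartesianProduct⁺ (choices-unique a _) (cartesianProduct⁺ (choices-unique b _) (choices-unique c _))

  shapeOf-ofShape : ∀ s → All (λ o → shapeOf o ≡ s) (ofShape s)
  shapeOf-ofShape (a , b , c) = All.tabulate λ {o} o∈ → shape-of o o∈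
    where
    shape-of : ∀ o → o ∈ₗ ofShape (a , b , c) → shapeOf o ≡ (a , b , c)
    shape-of (x , y , z) o∈ with ∈-cartesianProduct⁻ (choices a _) _ o∈
    ... | x∈ , yz∈ with ∈-cartesianProduct⁻ (choices b _) (choices c _) yz∈
    ...   | y∈ , z∈ =
      cong₂ _,_ (is-just-choices x∈) (cong₂ _,_ (is-just-choices y∈) (is-just-choices z∈))

  ∈-ofShape : ∀ o → o ∈ₗ ofShape (shapeOf o)
  ∈-ofShape (x , y , z) =
    ∈-cartesianProduct⁺ (∈-choices x) (∈-cartesianProduct⁺ (∈-choices y) (∈-choices z))

  multiplicity : Shape → ℕ
  multiplicity (a , b , c) = (if a then classSize neutral else 1)
                           * ((if b then classSize cyclic else 1)
                           * (if c then classSize involution else 1))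

  length-ofShape : ∀ s → length (ofShape s) ≡ multiplicity s
  length-ofShape (a , b , c) = begin
    length (ofShape (a , b , c))
      ≡⟨ length-cartesianProduct (choices a _) _ ⟩
    length (choices a _) * length (cartesianProduct (choices b _) (choices c _))
      ≡⟨ cong₂ _*_ (length-choices a _) (length-cartesianProduct (choices b _) (choices c _)) ⟩
    (if a then _ else 1) * (length (choices b _) * length (choices c _))
      ≡⟨ cong₂ (λ x y → (if a then _ else 1) * (x * y)) (length-choices b _) (length-choices c _) ⟩
    multiplicity (a , b , c)
      ∎
    where open ≡-Reasoning

  omissions : List Omission
  omissions = concatMap ofShape shapes

  omissions-unique : Unique omissions
  omissions-unique = concatMap-unique shapeOf ofShape ofShape-unique shapeOf-ofShape shapes-unique

  ∈-omissions : ∀ o → o ∈ₗ omissions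
  ∈-omissions o = ∈-concatMap⁺ ofShape (Any.map (λ { refl → ∈-ofShape o }) (∈-shapes (shapeOf o)))

  groupedByWeight : List (List ℕ × ℕ)
  groupedByWeight =
      (multiplicity (false , false , false) ∷ [] , N n ∸ 0)
    ∷ ( multiplicity (true , false , false) ∷ multiplicity (false , true , false)
      ∷ multiplicity (false , false , true) ∷ [] , N n ∸ 1)
    ∷ ( multiplicity (true , true , false) ∷ multiplicity (true , false , true)
      ∷ multiplicity (false , true , true) ∷ [] , N n ∸ 2)
    ∷ (multiplicity (true , true , true) ∷ [] , N n ∸ 3)
    ∷ []

  2^[2n∸2]≡m*m : 2 ^ (2 * n ∸ 2) ≡ m * m
  2^[2n∸2]≡m*m = trans (cong (2 ^_) 2n∸2≡[2+j]+[2+j]) (^-distribˡ-+-* 2 (2 + j) (2 + j))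
    where
    2n∸2≡[2+j]+[2+j] : 2 * n ∸ 2 ≡ (2 + j) + (2 + j)
    2n∸2≡[2+j]+[2+j] =
      solve 1 (λ j → con 1 :+ (j :+ ((con 3 :+ j) :+ con 0)) := (con 2 :+ j) :+ (con 2 :+ j)) refl j

  grouped≡target : map (λ (cs , e) → sum cs , e) groupedByWeight ≡ targetPoly n
  grouped≡target = cong (λ (x , y , z) → (1 , N n) ∷ (x , N n ∸ 1) ∷ (y , N n ∸ 2) ∷ (z , N n ∸ 3) ∷ [])
    (cong₂ _,_ (trans (weight-1-total (m ∸ 1) m M≡m) (sym N≡m+m))
      (cong₂ _,_ (trans (weight-2-total (m ∸ 1) m M≡m) (cong (λ x → x + m ∸ 1) (sym 2^[2n∸2]≡m*m)))
                 (trans (weight-3-total (m ∸ 1) m M≡m) (cong (_∸ m) (sym 2^[2n∸2]≡m*m)))))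

  count-of-size : ∀ k →
    length (filter (λ o → ∣ retained o ∣ ≟ k) omissions) ≡ coeff (targetPoly n) k
  count-of-size k = begin
    length (filter (λ o → ∣ retained o ∣ ≟ k) (concatMap ofShape shapes))
      ≡⟨ length-filter-concatMap (∣_∣ ∘ retained) ofShape (λ s → N n ∸ weight s) homogeneous shapes k ⟩
    coeff (map (λ s → length (ofShape s) , N n ∸ weight s) shapes) k
      ≡⟨ cong (λ p → coeff p k) (map-cong (λ s → cong (_, N n ∸ weight s) (length-ofShape s)) shapes) ⟩
    -- unfolding `shapes`, the list of monomials is literally the concatenation of the groups
    coeff (concatMap (λ (cs , e) → map (_, e) cs) groupedByWeight) k
      ≡⟨ collect-like-terms groupedByWeight k ⟩
    coeff (map (λ (cs , e) → sum cs , e) groupedByWeight) k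
      ≡⟨ cong (λ p → coeff p k) grouped≡target ⟩
    coeff (targetPoly n) k
      ∎
    where
    open ≡-Reasoning
    homogeneous : ∀ s → All (λ o → ∣ retained o ∣ ≡ N n ∸ weight s) (ofShape s)
    homogeneous s =
      All.map (λ {o} shape≡ → trans (∣retained∣ o) (cong (λ s → N n ∸ weight s) shape≡)) (shapeOf-ofShape s)

mainTheorem7 : (n : ℕ) → 3 ≤ n → (k : ℕ) → NumResolving n k (coeff (targetPoly n) k)
mainTheorem7 0             ()                k
mainTheorem7 1             (s≤s ())          k
mainTheorem7 2             (s≤s (s≤s ()))    k
mainTheorem7 (suc (suc (suc j))) _ k =
    map retained (filter of-size omissions)
  , map⁺ retained-injective (filter⁺ of-size {omissions} omissions-unique)
  , trans (length-map retained (filter of-size omissions)) (count-of-size k)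
  , λ U → mk⇔ listed⇒ ⇒listed
  where
  open PowerGraph j
  of-size : ∀ o → Dec (∣ retained o ∣ ≡ k)
  of-size o = ∣ retained o ∣ ≟ k
  listed⇒ : ∀ {U} → U ∈ₗ map retained (filter of-size omissions) → ∣ U ∣ ≡ k × Resolving n U
  listed⇒ U∈ with ∈-map∘filter⁻ retained of-size {xs = omissions} U∈
  ... | o , _ , refl , size = size , from resolving⇔sparse (retained-sparse o)
  ⇒listed : ∀ {U} → ∣ U ∣ ≡ k × Resolving n U → U ∈ₗ map retained (filter of-size omissions)
  ⇒listed {U} (size , resolving) =
    ∈-map∘filter⁺ retained of-size {xs = omissions}
      (omissionOf U , ∈-omissions _ , sym U≡ , trans (cong ∣_∣ U≡) size)
    where
    U≡ : retained (omissionOf U) ≡ U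
    U≡ = retained-omissionOf (to resolving⇔sparse resolving)
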